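{- If $\alpha$ is an odd norm-perfect Gaussian integer, then $\alpha=\pi^k\gamma^2$ for some Gaussian prime $\pi$, some Gaussian integer $\gamma$ with $\gcd(\pi,\gamma)=1$, and some odd rational integer $k$.
   Context: $\mathbb{Z}[i]$ denotes the Gaussian integers, with norm $N(a+bi)=a^2+b^2$. A Gaussian integer is called even if it is divisible by $1+i$, and odd otherwise. The sum-of-divisors function (Spira) is defined as follows: write a nonzero Gaussian integer as $\eta=\varepsilon\prod_i \pi_i^{k_i}$ with $\varepsilon\in\{\pm1,\pm i\}$ a unit and each $\pi_i$ a Gaussian prime in the first quadrant ($\mathrm{Re}(\pi_i)>0$, $\mathrm{Im}(\pi_i)\ge 0$), pairwise non-associate; then $\sigma(\eta)=\prod_i \frac{\pi_i^{k_i+1}-1}{\pi_i-1}$. A Gaussian integer $\eta$ is norm-perfect if $N(\sigma(\eta))=N(1+i)N(\eta)=2N(\eta)$. -}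

module Defs where

open import Data.Nat as ℕ using (ℕ; zero; suc)
open import Data.Integer as ℤ using (ℤ; +_; 0ℤ; 1ℤ)
open import Data.Product using (Σ; ∃; _×_; _,_; proj₁; proj₂)
open import Data.Sum using (_⊎_)
open import Data.List using (List; []; _∷_)
open import Data.List.Relation.Unary.All using (All)
open import Data.List.Relation.Unary.AllPairs using (AllPairs)
open import Relation.Binary.PropositionalEquality using (_≡_; _≢_)
open import Relation.Nullary using (¬_)

record 𝔾 : Set where
  constructor _+_i
  field
    re : ℤ
    im : ℤ
open 𝔾 public

infixl 6 _+ᵍ_ _-ᵍ_
infixl 7 _*ᵍ_
infixr 8 _^ᵍ_

0ᵍ 1ᵍ 1+i : 𝔾
0ᵍ = 0ℤ + 0ℤ i
1ᵍ = 1ℤ + 0ℤ i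
1+i = 1ℤ + 1ℤ i

_+ᵍ_ : 𝔾 → 𝔾 → 𝔾
(a + b i) +ᵍ (c + d i) = (a ℤ.+ c) + (b ℤ.+ d) i

-ᵍ_ : 𝔾 → 𝔾
-ᵍ (a + b i) = (ℤ.- a) + (ℤ.- b) i

_-ᵍ_ : 𝔾 → 𝔾 → 𝔾
x -ᵍ y = x +ᵍ (-ᵍ y)

_*ᵍ_ : 𝔾 → 𝔾 → 𝔾
(a + b i) *ᵍ (c + d i) = (a ℤ.* c ℤ.- b ℤ.* d) + (a ℤ.* d ℤ.+ b ℤ.* c) i

_^ᵍ_ : 𝔾 → ℕ → 𝔾
x ^ᵍ zero = 1ᵍ
x ^ᵍ suc n = x *ᵍ (x ^ᵍ n)

N : 𝔾 → ℤ
N (a + b i) = a ℤ.* a ℤ.+ b ℤ.* b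

_∣ᵍ_ : 𝔾 → 𝔾 → Set
d ∣ᵍ x = ∃ λ q → x ≡ q *ᵍ d

IsUnit : 𝔾 → Set
IsUnit u = ∃ λ v → u *ᵍ v ≡ 1ᵍ

Associated : 𝔾 → 𝔾 → Set
Associated x y = ∃ λ u → IsUnit u × x ≡ u *ᵍ y

-- Gaussian prime (irreducible element of the UFD ℤ[i])
GaussianPrime : 𝔾 → Set
GaussianPrime p = p ≢ 0ᵍ × ¬ IsUnit p
                × (∀ a b → p ≡ a *ᵍ b → IsUnit a ⊎ IsUnit b)

CoprimeG : 𝔾 → 𝔾 → Set
CoprimeG x y = ∀ d → d ∣ᵍ x → d ∣ᵍ y → IsUnit d

Odd𝔾 : 𝔾 → Set
Odd𝔾 x = ¬ (1+i ∣ᵍ x)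

FirstQuadrant : 𝔾 → Set
FirstQuadrant p = (0ℤ ℤ.< re p) × (0ℤ ℤ.≤ im p)

geomSum : 𝔾 → ℕ → 𝔾
geomSum p zero = 1ᵍ
geomSum p (suc k) = geomSum p k +ᵍ p ^ᵍ suc k

ValidFactorisation : List (𝔾 × ℕ) → Set
ValidFactorisation fs =
  All (λ pk → GaussianPrime (proj₁ pk) × FirstQuadrant (proj₁ pk) × 1 ℕ.≤ proj₂ pk) fs
  × AllPairs (λ pk ql → ¬ Associated (proj₁ pk) (proj₁ ql)) fs

evalFact : List (𝔾 × ℕ) → 𝔾
evalFact [] = 1ᵍ
evalFact ((p , k) ∷ fs) = p ^ᵍ k *ᵍ evalFact fs

sigmaFact : List (𝔾 × ℕ) → 𝔾
sigmaFact [] = 1ᵍ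
sigmaFact ((p , k) ∷ fs) = geomSum p k *ᵍ sigmaFact fs

-- σ(η) = s  (Spira), via a factorisation η = ε ∏ πᵢ^kᵢ
IsSigma : 𝔾 → 𝔾 → Set
IsSigma η s = Σ 𝔾 λ ε → Σ (List (𝔾 × ℕ)) λ fs →
  IsUnit ε × ValidFactorisation fs × η ≡ ε *ᵍ evalFact fs × s ≡ sigmaFact fs

NormPerfect : 𝔾 → Set
NormPerfect η = ∃ λ s → IsSigma η s × N s ≡ + 2 ℤ.* N η

OddNat : ℕ → Set
OddNat k = ∃ λ m → k ≡ suc (2 ℕ.* m)

module Submission where

-- An odd α has only odd prime factors, i.e. primes ≡ 1 modulo 1 + i, so 1 + π + ⋯ + π^k ≡ k + 1
-- modulo 1 + i. As N(α) is odd, N(σ(α)) = 2 N(α) is divisible by 2 but not by 4, so exactly one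
-- factor 1 + π + ⋯ + π^k of σ(α) is divisible by 1 + i: exactly one exponent k is odd. Hence
-- α = ε π^k γ² where, by Euclid's lemma (from the Euclidean algorithm in ℤ[i]), π does not divide
-- γ; the unit ε is absorbed into the associate ε π of π.

open import Defs
open import Relation.Binary.PropositionalEquality
open import Function using (_∘_)
open import Data.Empty using (⊥-elim)
open import Algebra.Bundles using (CommutativeRing)
open import Algebra.Structures {A = 𝔾} _≡_ using (IsCommutativeRing)
open import Data.Integer as ℤ using (ℤ; +_; 0ℤ; 1ℤ; -1ℤ; ∣_∣)
import Data.Integer.Properties as ℤₚ
open import Data.Integer.DivMod using (_%ℕ_; _/ℕ_; a≡a%ℕn+[a/ℕn]*n; n%ℕd<d)
open import Data.Integer.Tactic.RingSolver as ℤ-Solver using ()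
open import Data.Nat as ℕ using (ℕ; zero; suc; s≤s; _≤_; _<_)
import Data.Nat.Properties as ℕₚ
open import Data.Nat.Induction using (<-wellFounded)
open import Data.Nat.Tactic.RingSolver as ℕ-Solver using ()
open import Data.List using (List; []; _∷_)
open import Data.List.Membership.Propositional using (_∈_)
open import Data.List.Relation.Unary.All as All using (All; []; _∷_)
open import Data.List.Relation.Unary.AllPairs using (_∷_)
open import Data.List.Relation.Unary.Any using (here; there)
open import Data.Maybe using (Maybe; just; nothing)
open import Data.Product using (Σ; ∃; _×_; _,_; proj₁; proj₂)
open import Data.Sum using (_⊎_; inj₁; inj₂; reduce)
import Data.Sum as Sum
open import Induction.WellFounded using (Acc; acc)
open import Level using (0ℓ)
open import Relation.Nullary using (¬_; Dec; yes; no; contradiction)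
open import Data.Nat.Divisibility using (divides; ∣1⇒≡1)
open import Tactic.RingSolver using (solve-∀)
import Tactic.RingSolver.Core.AlmostCommutativeRing as ACR

-- ℤ[i] as a commutative ring

+ᵍ-*ᵍ-isCommutativeRing : IsCommutativeRing _+ᵍ_ _*ᵍ_ (-ᵍ_) 0ᵍ 1ᵍ
+ᵍ-*ᵍ-isCommutativeRing = record
  { isRing = record
    { +-isAbelianGroup = record
      { isGroup = record
        { isMonoid = record
          { isSemigroup = record
            { isMagma = record { isEquivalence = isEquivalence ; ∙-cong = cong₂ _+ᵍ_ }
            ; assoc = λ { (a + b i) (c + d i) (e + f i) → cong₂ _+_i (ℤₚ.+-assoc a c e) (ℤₚ.+-assoc b d f) } }
          ; identity = (λ { (a + b i) → cong₂ _+_i (ℤₚ.+-identityˡ a) (ℤₚ.+-identityˡ b) })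
                     , (λ { (a + b i) → cong₂ _+_i (ℤₚ.+-identityʳ a) (ℤₚ.+-identityʳ b) }) }
        ; inverse = (λ { (a + b i) → cong₂ _+_i (ℤₚ.+-inverseˡ a) (ℤₚ.+-inverseˡ b) })
                  , (λ { (a + b i) → cong₂ _+_i (ℤₚ.+-inverseʳ a) (ℤₚ.+-inverseʳ b) })
        ; ⁻¹-cong = cong (-ᵍ_) }
      ; comm = λ { (a + b i) (c + d i) → cong₂ _+_i (ℤₚ.+-comm a c) (ℤₚ.+-comm b d) } }
    ; *-cong = cong₂ _*ᵍ_
    ; *-assoc = λ { (a + b i) (c + d i) (e + f i) → cong₂ _+_i (*-assoc-re a b c d e f) (*-assoc-im a b c d e f) }
    ; *-identity = (λ { (a + b i) → cong₂ _+_i (*-identityˡ-re a b) (*-identityˡ-im a b) })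
                 , (λ { (a + b i) → cong₂ _+_i (*-identityʳ-re a b) (*-identityʳ-im a b) })
    ; distrib = (λ { (a + b i) (c + d i) (e + f i) → cong₂ _+_i (distribˡ-re a b c d e f) (distribˡ-im a b c d e f) })
              , (λ { (a + b i) (c + d i) (e + f i) → cong₂ _+_i (distribʳ-re a b c d e f) (distribʳ-im a b c d e f) }) }
  ; *-comm = λ { (a + b i) (c + d i) → cong₂ _+_i (*-comm-re a b c d) (*-comm-im a b c d) } }
  where
  open import Data.Integer using (_+_; _*_; _-_)
  *-assoc-re : ∀ a b c d e f → (a * c - b * d) * e - (a * d + b * c) * f ≡ a * (c * e - d * f) - b * (c * f + d * e)
  *-assoc-re = ℤ-Solver.solve-∀
  *-assoc-im : ∀ a b c d e f → (a * c - b * d) * f + (a * d + b * c) * e ≡ a * (c * f + d * e) + b * (c * e - d * f)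
  *-assoc-im = ℤ-Solver.solve-∀
  *-identityˡ-re : ∀ a b → 1ℤ * a - 0ℤ * b ≡ a
  *-identityˡ-re = ℤ-Solver.solve-∀
  *-identityˡ-im : ∀ a b → 1ℤ * b + 0ℤ * a ≡ b
  *-identityˡ-im = ℤ-Solver.solve-∀
  *-identityʳ-re : ∀ a b → a * 1ℤ - b * 0ℤ ≡ a
  *-identityʳ-re = ℤ-Solver.solve-∀
  *-identityʳ-im : ∀ a b → a * 0ℤ + b * 1ℤ ≡ b
  *-identityʳ-im = ℤ-Solver.solve-∀
  distribˡ-re : ∀ a b c d e f → a * (c + e) - b * (d + f) ≡ (a * c - b * d) + (a * e - b * f)
  distribˡ-re = ℤ-Solver.solve-∀
  distribˡ-im : ∀ a b c d e f → a * (d + f) + b * (c + e) ≡ (a * d + b * c) + (a * f + b * e)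
  distribˡ-im = ℤ-Solver.solve-∀
  distribʳ-re : ∀ a b c d e f → (c + e) * a - (d + f) * b ≡ (c * a - d * b) + (e * a - f * b)
  distribʳ-re = ℤ-Solver.solve-∀
  distribʳ-im : ∀ a b c d e f → (c + e) * b + (d + f) * a ≡ (c * b + d * a) + (e * b + f * a)
  distribʳ-im = ℤ-Solver.solve-∀
  *-comm-re : ∀ a b c d → a * c - b * d ≡ c * a - d * b
  *-comm-re = ℤ-Solver.solve-∀
  *-comm-im : ∀ a b c d → a * d + b * c ≡ c * b + d * a
  *-comm-im = ℤ-Solver.solve-∀

+ᵍ-*ᵍ-commutativeRing : CommutativeRing 0ℓ 0ℓ
+ᵍ-*ᵍ-commutativeRing = record { isCommutativeRing = +ᵍ-*ᵍ-isCommutativeRing }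

𝔾-ring : ACR.AlmostCommutativeRing 0ℓ 0ℓ
𝔾-ring = ACR.fromCommutativeRing +ᵍ-*ᵍ-commutativeRing 0ᵍ≟_
  where
  -- Without a zero test the solver fails on goals such as 0ᵍ ≡ 0ᵍ *ᵍ x.
  0ᵍ≟_ : ∀ x → Maybe (0ᵍ ≡ x)
  0ᵍ≟ (a + b i) with 0ℤ ℤ.≟ a | 0ℤ ℤ.≟ b
  ... | yes refl | yes refl = just refl
  ... | _        | _        = nothing

open CommutativeRing +ᵍ-*ᵍ-commutativeRing public
  using () renaming (*-assoc to *ᵍ-assoc; *-comm to *ᵍ-comm; *-identityˡ to *ᵍ-identityˡ;
                     zeroˡ to *ᵍ-zeroˡ; zeroʳ to *ᵍ-zeroʳ; distribʳ to *ᵍ-distribʳ-+ᵍ;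
                     +-identityˡ to +ᵍ-identityˡ)

^ᵍ-distribˡ-+-*ᵍ : ∀ x m n → x ^ᵍ (m ℕ.+ n) ≡ x ^ᵍ m *ᵍ x ^ᵍ n
^ᵍ-distribˡ-+-*ᵍ x zero n = sym (*ᵍ-identityˡ (x ^ᵍ n))
^ᵍ-distribˡ-+-*ᵍ x (suc m) n = trans (cong (x *ᵍ_) (^ᵍ-distribˡ-+-*ᵍ x m n)) (sym (*ᵍ-assoc x (x ^ᵍ m) (x ^ᵍ n)))

^ᵍ-double : ∀ x m → x ^ᵍ (2 ℕ.* m) ≡ x ^ᵍ m *ᵍ x ^ᵍ m
^ᵍ-double x m = trans (cong (λ n → x ^ᵍ (m ℕ.+ n)) (ℕₚ.+-identityʳ m)) (^ᵍ-distribˡ-+-*ᵍ x m m)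

^ᵍ-distribʳ-*ᵍ : ∀ x y n → (x *ᵍ y) ^ᵍ n ≡ x ^ᵍ n *ᵍ y ^ᵍ n
^ᵍ-distribʳ-*ᵍ x y zero = refl
^ᵍ-distribʳ-*ᵍ x y (suc n) = trans (cong ((x *ᵍ y) *ᵍ_) (^ᵍ-distribʳ-*ᵍ x y n)) (interchange x y (x ^ᵍ n) (y ^ᵍ n))
  where
  interchange : ∀ x y u v → (x *ᵍ y) *ᵍ (u *ᵍ v) ≡ (x *ᵍ u) *ᵍ (y *ᵍ v)
  interchange = solve-∀ 𝔾-ring

-- Divisibility and units

∣ᵍ-refl : ∀ x → x ∣ᵍ x
∣ᵍ-refl x = 1ᵍ , sym (*ᵍ-identityˡ x)

∣ᵍ-trans : ∀ {d x y} → d ∣ᵍ x → x ∣ᵍ y → d ∣ᵍ y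
∣ᵍ-trans {d} (p , refl) (q , refl) = q *ᵍ p , sym (*ᵍ-assoc q p d)

∣ᵍ-*ˡ : ∀ {d x} y → d ∣ᵍ x → d ∣ᵍ (y *ᵍ x)
∣ᵍ-*ˡ {d} y (p , refl) = y *ᵍ p , sym (*ᵍ-assoc y p d)

∣ᵍ-*ʳ : ∀ {d x} y → d ∣ᵍ x → d ∣ᵍ (x *ᵍ y)
∣ᵍ-*ʳ {d} {x} y d∣x = subst (d ∣ᵍ_) (*ᵍ-comm y x) (∣ᵍ-*ˡ y d∣x)

∣ᵍ-+ : ∀ {d x y} → d ∣ᵍ x → d ∣ᵍ y → d ∣ᵍ (x +ᵍ y)
∣ᵍ-+ {d} (p , refl) (q , refl) = p +ᵍ q , sym (*ᵍ-distribʳ-+ᵍ d p q)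

*ᵍ-mono-∣ᵍ : ∀ {d e x y} → d ∣ᵍ x → e ∣ᵍ y → (d *ᵍ e) ∣ᵍ (x *ᵍ y)
*ᵍ-mono-∣ᵍ {d} {e} (p , refl) (q , refl) = p *ᵍ q , interchange p d q e
  where
  interchange : ∀ p d q e → (p *ᵍ d) *ᵍ (q *ᵍ e) ≡ (p *ᵍ q) *ᵍ (d *ᵍ e)
  interchange = solve-∀ 𝔾-ring

inverse-cancelˡ : ∀ u v → u *ᵍ v ≡ 1ᵍ → ∀ x → x ≡ v *ᵍ (u *ᵍ x)
inverse-cancelˡ u v uv≡1 x = begin
  x                ≡⟨ sym (*ᵍ-identityˡ x) ⟩
  1ᵍ *ᵍ x          ≡⟨ cong (_*ᵍ x) (sym uv≡1) ⟩
  (u *ᵍ v) *ᵍ x    ≡⟨ rearrange u v x ⟩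
  v *ᵍ (u *ᵍ x)    ∎
  where
  open ≡-Reasoning
  rearrange : ∀ u v x → (u *ᵍ v) *ᵍ x ≡ v *ᵍ (u *ᵍ x)
  rearrange = solve-∀ 𝔾-ring

IsUnit-*ᵍ : ∀ {x y} → IsUnit x → IsUnit y → IsUnit (x *ᵍ y)
IsUnit-*ᵍ {x} {y} (v , xv≡1) (w , yw≡1) = v *ᵍ w , (begin
  (x *ᵍ y) *ᵍ (v *ᵍ w)  ≡⟨ interchange x y v w ⟩
  (x *ᵍ v) *ᵍ (y *ᵍ w)  ≡⟨ cong₂ _*ᵍ_ xv≡1 yw≡1 ⟩
  1ᵍ                    ∎)
  where
  open ≡-Reasoning
  interchange : ∀ x y v w → (x *ᵍ y) *ᵍ (v *ᵍ w) ≡ (x *ᵍ v) *ᵍ (y *ᵍ w)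
  interchange = solve-∀ 𝔾-ring

IsUnit-^ᵍ : ∀ {u} → IsUnit u → ∀ n → IsUnit (u ^ᵍ n)
IsUnit-^ᵍ u-unit zero = 1ᵍ , refl
IsUnit-^ᵍ {u} u-unit (suc n) = IsUnit-*ᵍ {u} {u ^ᵍ n} u-unit (IsUnit-^ᵍ u-unit n)

IsUnit-*ᵍʳ : ∀ x {y} → IsUnit (x *ᵍ y) → IsUnit y
IsUnit-*ᵍʳ x {y} (w , xyw≡1) = x *ᵍ w , trans (rearrange x y w) xyw≡1
  where
  rearrange : ∀ x y w → y *ᵍ (x *ᵍ w) ≡ (x *ᵍ y) *ᵍ w
  rearrange = solve-∀ 𝔾-ring

∣ᵍ-unit-cancelˡ : ∀ {d u x} → IsUnit u → d ∣ᵍ (u *ᵍ x) → d ∣ᵍ x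
∣ᵍ-unit-cancelˡ {d} {u} {x} (v , uv≡1) d∣ux =
  subst (d ∣ᵍ_) (sym (inverse-cancelˡ u v uv≡1 x)) (∣ᵍ-*ˡ {d} {u *ᵍ x} v d∣ux)

Associated-sym : ∀ {x y} → Associated x y → Associated y x
Associated-sym {y = y} (u , (v , uv≡1) , refl) = v , (u , trans (*ᵍ-comm v u) uv≡1) , inverse-cancelˡ u v uv≡1 y

CoprimeG-*ᵍ-unit : ∀ {u w x y} → IsUnit u → IsUnit w → CoprimeG x y → CoprimeG (u *ᵍ x) (w *ᵍ y)
CoprimeG-*ᵍ-unit {u} {w} {x} {y} u-unit w-unit coprime d d∣ux d∣wy =
  coprime d (∣ᵍ-unit-cancelˡ {d} {u} {x} u-unit d∣ux) (∣ᵍ-unit-cancelˡ {d} {w} {y} w-unit d∣wy)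

-- The norm and Euclidean division

conj : 𝔾 → 𝔾
conj (a + b i) = a + (ℤ.- b) i

Nℕ : 𝔾 → ℕ
Nℕ (a + b i) = ∣ a ∣ ℕ.* ∣ a ∣ ℕ.+ ∣ b ∣ ℕ.* ∣ b ∣

N-*ᵍ : ∀ x y → N (x *ᵍ y) ≡ N x ℤ.* N y
N-*ᵍ (a + b i) (c + d i) = lagrange a b c d
  where
  open import Data.Integer using (_+_; _*_; _-_)
  lagrange : ∀ a b c d → (a * c - b * d) * (a * c - b * d) + (a * d + b * c) * (a * d + b * c)
                         ≡ (a * a + b * b) * (c * c + d * d)
  lagrange = ℤ-Solver.solve-∀

*ᵍ-conj : ∀ x → x *ᵍ conj x ≡ N x + 0ℤ i
*ᵍ-conj (a + b i) = cong₂ _+_i (re-part a b) (im-part a b)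
  where
  open import Data.Integer using (_+_; _*_; _-_; -_)
  re-part : ∀ a b → a * a - b * (- b) ≡ a * a + b * b
  re-part = ℤ-Solver.solve-∀
  im-part : ∀ a b → a * (- b) + b * a ≡ 0ℤ
  im-part = ℤ-Solver.solve-∀

N≡+Nℕ : ∀ x → N x ≡ + Nℕ x
N≡+Nℕ (a + b i) = begin
  a ℤ.* a ℤ.+ b ℤ.* b                        ≡⟨ cong₂ ℤ._+_ (square a) (square b) ⟩
  + (∣ a ∣ ℕ.* ∣ a ∣) ℤ.+ + (∣ b ∣ ℕ.* ∣ b ∣)  ≡⟨ ℤₚ.pos-+ (∣ a ∣ ℕ.* ∣ a ∣) _ ⟨
  + Nℕ (a + b i)                              ∎
  where
  open ≡-Reasoning
  square : ∀ a → a ℤ.* a ≡ + (∣ a ∣ ℕ.* ∣ a ∣)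
  square (+ n) = sym (ℤₚ.pos-* n n)
  square ℤ.-[1+ n ] = refl

Nℕ-*ᵍ : ∀ x y → Nℕ (x *ᵍ y) ≡ Nℕ x ℕ.* Nℕ y
Nℕ-*ᵍ x y = ℤₚ.+-injective (begin
  + Nℕ (x *ᵍ y)          ≡⟨ N≡+Nℕ (x *ᵍ y) ⟨
  N (x *ᵍ y)             ≡⟨ N-*ᵍ x y ⟩
  N x ℤ.* N y            ≡⟨ cong₂ ℤ._*_ (N≡+Nℕ x) (N≡+Nℕ y) ⟩
  + Nℕ x ℤ.* + Nℕ y      ≡⟨ ℤₚ.pos-* (Nℕ x) (Nℕ y) ⟨
  + (Nℕ x ℕ.* Nℕ y)      ∎)
  where open ≡-Reasoning

Nℕ-conj : ∀ x → Nℕ (conj x) ≡ Nℕ x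
Nℕ-conj (a + b i) = cong (λ n → ∣ a ∣ ℕ.* ∣ a ∣ ℕ.+ n ℕ.* n) (ℤₚ.∣-i∣≡∣i∣ b)

Nℕ≡0⇒≡0ᵍ : ∀ x → Nℕ x ≡ 0 → x ≡ 0ᵍ
Nℕ≡0⇒≡0ᵍ (a + b i) N≡0 =
  cong₂ _+_i (square≡0 a (ℕₚ.m+n≡0⇒m≡0 _ N≡0)) (square≡0 b (ℕₚ.m+n≡0⇒n≡0 _ N≡0))
  where
  square≡0 : ∀ a → ∣ a ∣ ℕ.* ∣ a ∣ ≡ 0 → a ≡ 0ℤ
  square≡0 a aa≡0 = ℤₚ.∣i∣≡0⇒i≡0 (reduce (ℕₚ.m*n≡0⇒m≡0∨n≡0 ∣ a ∣ aa≡0))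

record CentredDivision (n : ℤ) (m : ℕ) : Set where
  field
    quotient remainder : ℤ
    remainder≡ : remainder ≡ n ℤ.- quotient ℤ.* + m
    remainder-small : 2 ℕ.* ∣ remainder ∣ ≤ m

centredDivision : ∀ n m .{{_ : ℕ.NonZero m}} → CentredDivision n m
centredDivision n m with 2 ℕ.* (n %ℕ m) ℕ.≤? m
... | yes small = record
  { quotient = n /ℕ m ; remainder = + r ; remainder-small = small
  ; remainder≡ = trans (r≡[r+s]-s (+ r) (n /ℕ m ℤ.* + m)) (cong (ℤ._- n /ℕ m ℤ.* + m) (sym n≡)) }
  where
  r : ℕ
  r = n %ℕ m
  n≡ : n ≡ + r ℤ.+ n /ℕ m ℤ.* + m
  n≡ = a≡a%ℕn+[a/ℕn]*n n m
  r≡[r+s]-s : ∀ r s → r ≡ (r ℤ.+ s) ℤ.- s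
  r≡[r+s]-s = ℤ-Solver.solve-∀
... | no large = record
  { quotient = n /ℕ m ℤ.+ 1ℤ ; remainder = r ℤ.⊖ m ; remainder≡ = r⊖m≡ ; remainder-small = small }
  where
  r : ℕ
  r = n %ℕ m
  r<m : r < m
  r<m = n%ℕd<d n m
  r⊖m≡ : r ℤ.⊖ m ≡ n ℤ.- (n /ℕ m ℤ.+ 1ℤ) ℤ.* + m
  r⊖m≡ = begin
    r ℤ.⊖ m
      ≡⟨ ℤₚ.m-n≡m⊖n r m ⟨
    + r ℤ.- + m
      ≡⟨ shift (+ r) (n /ℕ m) (+ m) ⟩
    (+ r ℤ.+ n /ℕ m ℤ.* + m) ℤ.- (n /ℕ m ℤ.+ 1ℤ) ℤ.* + m
      ≡⟨ cong (ℤ._- (n /ℕ m ℤ.+ 1ℤ) ℤ.* + m) (sym (a≡a%ℕn+[a/ℕn]*n n m)) ⟩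
    n ℤ.- (n /ℕ m ℤ.+ 1ℤ) ℤ.* + m
      ∎
    where
    open ≡-Reasoning
    shift : ∀ r q m → r ℤ.- m ≡ (r ℤ.+ q ℤ.* m) ℤ.- (q ℤ.+ 1ℤ) ℤ.* m
    shift = ℤ-Solver.solve-∀
  small : 2 ℕ.* ∣ r ℤ.⊖ m ∣ ≤ m
  small = begin
    2 ℕ.* ∣ r ℤ.⊖ m ∣        ≡⟨ cong (2 ℕ.*_) (ℤₚ.∣⊖∣-< r<m) ⟩
    2 ℕ.* (m ℕ.∸ r)          ≡⟨ double (m ℕ.∸ r) ⟩
    (m ℕ.∸ r) ℕ.+ (m ℕ.∸ r)  ≤⟨ ℕₚ.+-monoʳ-≤ (m ℕ.∸ r) (ℕₚ.m≤n+o⇒m∸n≤o m r m≤r+r) ⟩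
    (m ℕ.∸ r) ℕ.+ r          ≡⟨ ℕₚ.m∸n+n≡m (ℕₚ.<⇒≤ r<m) ⟩
    m                        ∎
    where
    open ℕₚ.≤-Reasoning
    double : ∀ t → 2 ℕ.* t ≡ t ℕ.+ t
    double = ℕ-Solver.solve-∀
    m≤r+r : m ≤ r ℕ.+ r
    m≤r+r = subst (m ≤_) (double r) (ℕₚ.<⇒≤ (ℕₚ.≰⇒> large))

half-square-bound : ∀ {k m u w} .{{_ : ℕ.NonZero m}} → k ℕ.* m ≡ u ℕ.* u ℕ.+ w ℕ.* w →
                    2 ℕ.* u ≤ m → 2 ℕ.* w ≤ m → 2 ℕ.* k ≤ m
half-square-bound {k} {m} {u} {w} km≡ 2u≤m 2w≤m = ℕₚ.*-cancelʳ-≤ (2 ℕ.* k) m m (ℕₚ.*-cancelˡ-≤ 2 (begin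
  2 ℕ.* (2 ℕ.* k ℕ.* m)                       ≡⟨ regroup k m ⟩
  4 ℕ.* (k ℕ.* m)                             ≡⟨ cong (4 ℕ.*_) km≡ ⟩
  4 ℕ.* (u ℕ.* u ℕ.+ w ℕ.* w)                 ≡⟨ expand u w ⟩
  (2 ℕ.* u) ℕ.* (2 ℕ.* u) ℕ.+ (2 ℕ.* w) ℕ.* (2 ℕ.* w)
                                              ≤⟨ ℕₚ.+-mono-≤ (ℕₚ.*-mono-≤ 2u≤m 2u≤m) (ℕₚ.*-mono-≤ 2w≤m 2w≤m) ⟩
  m ℕ.* m ℕ.+ m ℕ.* m                         ≡⟨ double (m ℕ.* m) ⟩
  2 ℕ.* (m ℕ.* m)                             ∎))
  where
  open ℕₚ.≤-Reasoning
  regroup : ∀ k m → 2 ℕ.* (2 ℕ.* k ℕ.* m) ≡ 4 ℕ.* (k ℕ.* m)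
  regroup = ℕ-Solver.solve-∀
  expand : ∀ u w → 4 ℕ.* (u ℕ.* u ℕ.+ w ℕ.* w) ≡ (2 ℕ.* u) ℕ.* (2 ℕ.* u) ℕ.+ (2 ℕ.* w) ℕ.* (2 ℕ.* w)
  expand = ℕ-Solver.solve-∀
  double : ∀ t → t ℕ.+ t ≡ 2 ℕ.* t
  double = ℕ-Solver.solve-∀

double≤⇒< : ∀ {k m} .{{_ : ℕ.NonZero m}} → 2 ℕ.* k ≤ m → k < m
double≤⇒< {zero} {m} _ = ℕ.>-nonZero⁻¹ m
double≤⇒< {suc k} 2k≤m = ℕₚ.<-≤-trans (ℕₚ.m<m+n (suc k) ℕ.z<s) 2k≤m

sub-*ᵍ-real : ∀ a b q₁ q₂ m →
              (a + b i) -ᵍ (q₁ + q₂ i) *ᵍ (m + 0ℤ i) ≡ (a ℤ.- q₁ ℤ.* m) + (b ℤ.- q₂ ℤ.* m) i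
sub-*ᵍ-real a b q₁ q₂ m = cong₂ _+_i (re-part a q₁ q₂ m) (im-part b q₁ q₂ m)
  where
  open import Data.Integer using (_+_; _*_; _-_; -_)
  re-part : ∀ a q₁ q₂ m → a + - (q₁ * m - q₂ * 0ℤ) ≡ a - q₁ * m
  re-part = ℤ-Solver.solve-∀
  im-part : ∀ b q₁ q₂ m → b + - (q₁ * 0ℤ + q₂ * m) ≡ b - q₂ * m
  im-part = ℤ-Solver.solve-∀

-- Divide x·conj(y) by N(y) componentwise with rounding to the nearest integer.
euclideanDivision : ∀ x y .{{_ : ℕ.NonZero (Nℕ y)}} → ∃ λ q → Nℕ (x -ᵍ q *ᵍ y) < Nℕ y
euclideanDivision x y = q , double≤⇒< {Nℕ r} 2Nr≤m
  where
  m : ℕ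
  m = Nℕ y
  z : 𝔾
  z = x *ᵍ conj y
  module D₁ = CentredDivision (centredDivision (re z) m)
  module D₂ = CentredDivision (centredDivision (im z) m)
  q r : 𝔾
  q = D₁.quotient + D₂.quotient i
  r = x -ᵍ q *ᵍ y
  distrib : ∀ x q y c → (x -ᵍ q *ᵍ y) *ᵍ c ≡ x *ᵍ c -ᵍ q *ᵍ (y *ᵍ c)
  distrib = solve-∀ 𝔾-ring
  y*conj-y≡ : y *ᵍ conj y ≡ (+ m) + 0ℤ i
  y*conj-y≡ = trans (*ᵍ-conj y) (cong (λ n → n + 0ℤ i) (N≡+Nℕ y))
  r*conj-y≡ : r *ᵍ conj y ≡ D₁.remainder + D₂.remainder i
  r*conj-y≡ = begin
    (x -ᵍ q *ᵍ y) *ᵍ conj y     ≡⟨ distrib x q y (conj y) ⟩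
    z -ᵍ q *ᵍ (y *ᵍ conj y)     ≡⟨ cong (λ w → z -ᵍ q *ᵍ w) y*conj-y≡ ⟩
    z -ᵍ q *ᵍ ((+ m) + 0ℤ i)    ≡⟨ sub-*ᵍ-real (re z) (im z) D₁.quotient D₂.quotient (+ m) ⟩
    (re z ℤ.- D₁.quotient ℤ.* + m) + (im z ℤ.- D₂.quotient ℤ.* + m) i
                                ≡⟨ cong₂ _+_i (sym D₁.remainder≡) (sym D₂.remainder≡) ⟩
    D₁.remainder + D₂.remainder i ∎
    where open ≡-Reasoning
  Nr*m≡ : Nℕ r ℕ.* m ≡ Nℕ (D₁.remainder + D₂.remainder i)
  Nr*m≡ = begin
    Nℕ r ℕ.* m                        ≡⟨ cong (Nℕ r ℕ.*_) (Nℕ-conj y) ⟨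
    Nℕ r ℕ.* Nℕ (conj y)              ≡⟨ Nℕ-*ᵍ r (conj y) ⟨
    Nℕ (r *ᵍ conj y)                  ≡⟨ cong Nℕ r*conj-y≡ ⟩
    Nℕ (D₁.remainder + D₂.remainder i) ∎
    where open ≡-Reasoning
  2Nr≤m : 2 ℕ.* Nℕ r ≤ m
  2Nr≤m = half-square-bound {Nℕ r} {m} {∣ D₁.remainder ∣} {∣ D₂.remainder ∣}
                            Nr*m≡ D₁.remainder-small D₂.remainder-small

-- Bézout's identity and Euclid's lemma

record Bézout (x y : 𝔾) : Set where
  field
    gcd s t : 𝔾
    gcd∣x : gcd ∣ᵍ x
    gcd∣y : gcd ∣ᵍ y
    gcd≡ : gcd ≡ s *ᵍ x +ᵍ t *ᵍ y

Bézout-zero : ∀ x → Bézout x 0ᵍ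
Bézout-zero x = record
  { gcd = x ; s = 1ᵍ ; t = 0ᵍ ; gcd∣x = ∣ᵍ-refl x ; gcd∣y = 0ᵍ , sym (*ᵍ-zeroˡ x) ; gcd≡ = identity x }
  where
  identity : ∀ x → x ≡ 1ᵍ *ᵍ x +ᵍ 0ᵍ *ᵍ 0ᵍ
  identity = solve-∀ 𝔾-ring

Bézout-step : ∀ x y q → Bézout y (x -ᵍ q *ᵍ y) → Bézout x y
Bézout-step x y q b = record
  { gcd = gcd ; s = t ; t = s -ᵍ t *ᵍ q
  ; gcd∣x = subst (gcd ∣ᵍ_) (sym (divide x y q)) (∣ᵍ-+ {gcd} {q *ᵍ y} (∣ᵍ-*ˡ {gcd} {y} q gcd∣x) gcd∣y)
  ; gcd∣y = gcd∣x
  ; gcd≡ = trans gcd≡ (regroup s t x y q) }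
  where
  open Bézout b
  divide : ∀ x y q → x ≡ q *ᵍ y +ᵍ (x -ᵍ q *ᵍ y)
  divide = solve-∀ 𝔾-ring
  regroup : ∀ s t x y q → s *ᵍ y +ᵍ t *ᵍ (x -ᵍ q *ᵍ y) ≡ t *ᵍ x +ᵍ (s -ᵍ t *ᵍ q) *ᵍ y
  regroup = solve-∀ 𝔾-ring

bézout : ∀ x y → Bézout x y
bézout x y = euclid-algorithm x y (<-wellFounded (Nℕ y))
  where
  euclid-algorithm : ∀ x y → Acc _<_ (Nℕ y) → Bézout x y
  euclid-algorithm x y (acc rec) = step (Nℕ y ℕ.≟ 0)
    where
    step : Dec (Nℕ y ≡ 0) → Bézout x y
    step (yes N≡0) = subst (Bézout x) (sym (Nℕ≡0⇒≡0ᵍ y N≡0)) (Bézout-zero x)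
    step (no N≢0) = Bézout-step x y q (euclid-algorithm y (x -ᵍ q *ᵍ y) (rec r<y))
      where
      division : ∃ λ q → Nℕ (x -ᵍ q *ᵍ y) < Nℕ y
      division = euclideanDivision x y {{ℕ.≢-nonZero N≢0}}
      q : 𝔾
      q = proj₁ division
      r<y : Nℕ (x -ᵍ q *ᵍ y) < Nℕ y
      r<y = proj₂ division

Associated⇒∣ᵍ : ∀ {x y} → Associated x y → x ∣ᵍ y
Associated⇒∣ᵍ {y = y} (u , (v , uv≡1) , x≡uy) = v , trans (inverse-cancelˡ u v uv≡1 y) (cong (v *ᵍ_) (sym x≡uy))

euclidsLemma : ∀ {p} a b → GaussianPrime p → p ∣ᵍ (a *ᵍ b) → p ∣ᵍ a ⊎ p ∣ᵍ b
euclidsLemma {p} a b (_ , _ , irreducible) p∣ab = Sum.map p∣a p∣b (irreducible q gcd p≡q*gcd)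
  where
  open Bézout (bézout p a)
  q : 𝔾
  q = proj₁ gcd∣x
  p≡q*gcd : p ≡ q *ᵍ gcd
  p≡q*gcd = proj₂ gcd∣x
  p∣a : IsUnit q → p ∣ᵍ a
  p∣a q-unit = ∣ᵍ-trans {p} {gcd} {a} (Associated⇒∣ᵍ (q , q-unit , p≡q*gcd)) gcd∣y
  p∣b : IsUnit gcd → p ∣ᵍ b
  p∣b (w , gcd*w≡1) = subst (p ∣ᵍ_) b≡ (∣ᵍ-+ {p} {w *ᵍ s *ᵍ b *ᵍ p} {w *ᵍ t *ᵍ (a *ᵍ b)}
    (∣ᵍ-*ˡ {p} {p} (w *ᵍ s *ᵍ b) (∣ᵍ-refl p)) (∣ᵍ-*ˡ {p} {a *ᵍ b} (w *ᵍ t) p∣ab))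
    where
    open ≡-Reasoning
    regroup : ∀ w s t p a b → w *ᵍ s *ᵍ b *ᵍ p +ᵍ w *ᵍ t *ᵍ (a *ᵍ b) ≡ (s *ᵍ p +ᵍ t *ᵍ a) *ᵍ w *ᵍ b
    regroup = solve-∀ 𝔾-ring
    b≡ : w *ᵍ s *ᵍ b *ᵍ p +ᵍ w *ᵍ t *ᵍ (a *ᵍ b) ≡ b
    b≡ = begin
      w *ᵍ s *ᵍ b *ᵍ p +ᵍ w *ᵍ t *ᵍ (a *ᵍ b) ≡⟨ regroup w s t p a b ⟩
      (s *ᵍ p +ᵍ t *ᵍ a) *ᵍ w *ᵍ b          ≡⟨ cong (λ g → g *ᵍ w *ᵍ b) gcd≡ ⟨
      gcd *ᵍ w *ᵍ b                          ≡⟨ cong (_*ᵍ b) gcd*w≡1 ⟩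
      1ᵍ *ᵍ b                                ≡⟨ *ᵍ-identityˡ b ⟩
      b                                      ∎

prime∤1 : ∀ {p} → GaussianPrime p → ¬ p ∣ᵍ 1ᵍ
prime∤1 {p} (_ , non-unit , _) (q , 1≡qp) = non-unit (q , trans (*ᵍ-comm p q) (sym 1≡qp))

prime∤*ᵍ : ∀ {p} x y → GaussianPrime p → ¬ p ∣ᵍ x → ¬ p ∣ᵍ y → ¬ p ∣ᵍ (x *ᵍ y)
prime∤*ᵍ x y p-prime p∤x p∤y = Sum.[ p∤x , p∤y ] ∘ euclidsLemma x y p-prime

prime∣prime⇒associated : ∀ {p q} → GaussianPrime p → GaussianPrime q → p ∣ᵍ q → Associated q p
prime∣prime⇒associated {p} (_ , p-non-unit , _) (_ , _ , q-irreducible) (t , q≡tp) with q-irreducible t p q≡tp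
... | inj₁ t-unit = t , t-unit , q≡tp
... | inj₂ p-unit = ⊥-elim (p-non-unit p-unit)

prime∤^ᵍ : ∀ {π q} → GaussianPrime π → GaussianPrime q → ¬ Associated q π → ∀ m → ¬ π ∣ᵍ (q ^ᵍ m)
prime∤^ᵍ π-prime q-prime q≁π zero = prime∤1 π-prime
prime∤^ᵍ {q = q} π-prime q-prime q≁π (suc m) =
  prime∤*ᵍ q (q ^ᵍ m) π-prime (q≁π ∘ prime∣prime⇒associated π-prime q-prime) (prime∤^ᵍ π-prime q-prime q≁π m)

prime∤⇒coprime : ∀ {π γ} → GaussianPrime π → ¬ π ∣ᵍ γ → CoprimeG π γ
prime∤⇒coprime {π} {γ} (_ , _ , irreducible) π∤γ d (t , π≡td) d∣γ with irreducible t d π≡td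
... | inj₁ t-unit = ⊥-elim (π∤γ (∣ᵍ-trans {π} {d} {γ} (Associated⇒∣ᵍ (t , t-unit , π≡td)) d∣γ))
... | inj₂ d-unit = d-unit

GaussianPrime-*ᵍ-unit : ∀ {u p} → IsUnit u → GaussianPrime p → GaussianPrime (u *ᵍ p)
GaussianPrime-*ᵍ-unit {u} {p} (v , uv≡1) (p≢0 , p-non-unit , irreducible) =
  up≢0 , p-non-unit ∘ IsUnit-*ᵍʳ u , up-irreducible
  where
  p≡v[up] : p ≡ v *ᵍ (u *ᵍ p)
  p≡v[up] = inverse-cancelˡ u v uv≡1 p
  up≢0 : u *ᵍ p ≢ 0ᵍ
  up≢0 up≡0 = p≢0 (trans p≡v[up] (trans (cong (v *ᵍ_) up≡0) (*ᵍ-zeroʳ v)))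
  up-irreducible : ∀ a b → u *ᵍ p ≡ a *ᵍ b → IsUnit a ⊎ IsUnit b
  up-irreducible a b up≡ab =
    Sum.map₁ (IsUnit-*ᵍʳ v) (irreducible (v *ᵍ a) b (trans p≡v[up] (trans (cong (v *ᵍ_) up≡ab) (sym (*ᵍ-assoc v a b)))))

-- Parity

Evenℤ Oddℤ : ℤ → Set
Evenℤ n = ∃ λ m → n ≡ + 2 ℤ.* m
Oddℤ n = ∃ λ m → n ≡ 1ℤ ℤ.+ + 2 ℤ.* m

evenℤ⊎oddℤ : ∀ n → Evenℤ n ⊎ Oddℤ n
evenℤ⊎oddℤ n with n %ℕ 2 | a≡a%ℕn+[a/ℕn]*n n 2 | n%ℕd<d n 2
... | 0 | n≡ | _ = inj₁ (n /ℕ 2 , trans n≡ (rearrange (n /ℕ 2)))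
  where
  rearrange : ∀ q → 0ℤ ℤ.+ q ℤ.* + 2 ≡ + 2 ℤ.* q
  rearrange = ℤ-Solver.solve-∀
... | 1 | n≡ | _ = inj₂ (n /ℕ 2 , trans n≡ (rearrange (n /ℕ 2)))
  where
  rearrange : ∀ q → 1ℤ ℤ.+ q ℤ.* + 2 ≡ 1ℤ ℤ.+ + 2 ℤ.* q
  rearrange = ℤ-Solver.solve-∀
... | suc (suc _) | _ | s≤s (s≤s ())

evenℤ⇒¬oddℤ : ∀ {n} → Evenℤ n → ¬ Oddℤ n
evenℤ⇒¬oddℤ (m , refl) (k , 2m≡1+2k) = contradiction (∣1⇒≡1 (divides ∣ m ℤ.- k ∣ 1≡∣m-k∣*2)) λ ()
  where
  open ≡-Reasoning
  1≡[1+2k]-2k : ∀ k → 1ℤ ≡ (1ℤ ℤ.+ + 2 ℤ.* k) ℤ.- + 2 ℤ.* k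
  1≡[1+2k]-2k = ℤ-Solver.solve-∀
  2m-2k≡[m-k]*2 : ∀ m k → + 2 ℤ.* m ℤ.- + 2 ℤ.* k ≡ (m ℤ.- k) ℤ.* + 2
  2m-2k≡[m-k]*2 = ℤ-Solver.solve-∀
  1≡∣m-k∣*2 : 1 ≡ ∣ m ℤ.- k ∣ ℕ.* 2
  1≡∣m-k∣*2 = begin
    1                                ≡⟨ cong ∣_∣ (1≡[1+2k]-2k k) ⟩
    ∣ (1ℤ ℤ.+ + 2 ℤ.* k) ℤ.- + 2 ℤ.* k ∣ ≡⟨ cong (λ n → ∣ n ℤ.- + 2 ℤ.* k ∣) 2m≡1+2k ⟨
    ∣ + 2 ℤ.* m ℤ.- + 2 ℤ.* k ∣       ≡⟨ cong ∣_∣ (2m-2k≡[m-k]*2 m k) ⟩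
    ∣ (m ℤ.- k) ℤ.* + 2 ∣             ≡⟨ ℤₚ.∣i*j∣≡∣i∣*∣j∣ (m ℤ.- k) (+ 2) ⟩
    ∣ m ℤ.- k ∣ ℕ.* 2                  ∎

≡1[mod1+i] : 𝔾 → Set
≡1[mod1+i] x = ∃ λ q → x ≡ 1ᵍ +ᵍ q *ᵍ 1+i

≡1[mod1+i]-*ᵍ : ∀ {x y} → ≡1[mod1+i] x → ≡1[mod1+i] y → ≡1[mod1+i] (x *ᵍ y)
≡1[mod1+i]-*ᵍ (q , refl) (r , refl) = q +ᵍ r +ᵍ q *ᵍ r *ᵍ 1+i , expand q r
  where
  expand : ∀ q r → (1ᵍ +ᵍ q *ᵍ 1+i) *ᵍ (1ᵍ +ᵍ r *ᵍ 1+i) ≡ 1ᵍ +ᵍ (q +ᵍ r +ᵍ q *ᵍ r *ᵍ 1+i) *ᵍ 1+i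
  expand = solve-∀ 𝔾-ring

≡1[mod1+i]-^ᵍ : ∀ {x} → ≡1[mod1+i] x → ∀ n → ≡1[mod1+i] (x ^ᵍ n)
≡1[mod1+i]-^ᵍ x≡1 zero = 0ᵍ , refl
≡1[mod1+i]-^ᵍ x≡1 (suc n) = ≡1[mod1+i]-*ᵍ x≡1 (≡1[mod1+i]-^ᵍ x≡1 n)

-- The witness comes from 2 = (1 - i)(1 + i).
≡1+≡1⇒1+i∣ : ∀ {x y} → ≡1[mod1+i] x → ≡1[mod1+i] y → 1+i ∣ᵍ (x +ᵍ y)
≡1+≡1⇒1+i∣ (q , refl) (r , refl) = 1ℤ + -1ℤ i +ᵍ q +ᵍ r , expand q r
  where
  expand : ∀ q r → (1ᵍ +ᵍ q *ᵍ 1+i) +ᵍ (1ᵍ +ᵍ r *ᵍ 1+i) ≡ (1ℤ + -1ℤ i +ᵍ q +ᵍ r) *ᵍ 1+i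
  expand = solve-∀ 𝔾-ring

1+i∣+≡1⇒≡1 : ∀ {x y} → 1+i ∣ᵍ x → ≡1[mod1+i] y → ≡1[mod1+i] (x +ᵍ y)
1+i∣+≡1⇒≡1 (q , refl) (r , refl) = q +ᵍ r , expand q r
  where
  expand : ∀ q r → q *ᵍ 1+i +ᵍ (1ᵍ +ᵍ r *ᵍ 1+i) ≡ 1ᵍ +ᵍ (q +ᵍ r) *ᵍ 1+i
  expand = solve-∀ 𝔾-ring

decompose-mod-1+i : ∀ a b r m → a ℤ.+ b ≡ r ℤ.+ + 2 ℤ.* m → a + b i ≡ (r + 0ℤ i) +ᵍ (m + (b ℤ.- m) i) *ᵍ 1+i
decompose-mod-1+i a b r m a+b≡r+2m = cong₂ _+_i re-part (im-part b m)
  where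
  open import Data.Integer using (_+_; _*_; _-_)
  a≡[a+b]-b : ∀ a b → a ≡ (a + b) - b
  a≡[a+b]-b = ℤ-Solver.solve-∀
  rearrange : ∀ r b m → (r + + 2 * m) - b ≡ r + (m * 1ℤ - (b - m) * 1ℤ)
  rearrange = ℤ-Solver.solve-∀
  im-part : ∀ b m → b ≡ 0ℤ + (m * 1ℤ + (b - m) * 1ℤ)
  im-part = ℤ-Solver.solve-∀
  re-part : a ≡ r + (m * 1ℤ - (b - m) * 1ℤ)
  re-part = trans (a≡[a+b]-b a b) (trans (cong (_- b) a+b≡r+2m) (rearrange r b m))

odd⇒≡1[mod1+i] : ∀ x → Odd𝔾 x → ≡1[mod1+i] x
odd⇒≡1[mod1+i] (a + b i) x-odd with evenℤ⊎oddℤ (a ℤ.+ b)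
... | inj₁ (m , a+b≡2m) = ⊥-elim (x-odd (q , trans x≡0+q[1+i] (+ᵍ-identityˡ (q *ᵍ 1+i))))
  where
  q : 𝔾
  q = m + (b ℤ.- m) i
  x≡0+q[1+i] : a + b i ≡ 0ᵍ +ᵍ q *ᵍ 1+i
  x≡0+q[1+i] = decompose-mod-1+i a b 0ℤ m (trans a+b≡2m (sym (ℤₚ.+-identityˡ (+ 2 ℤ.* m))))
... | inj₂ (m , a+b≡1+2m) = m + (b ℤ.- m) i , decompose-mod-1+i a b 1ℤ m a+b≡1+2m

≡1[mod1+i]⇒oddℤ-N : ∀ {x} → ≡1[mod1+i] x → Oddℤ (N x)
≡1[mod1+i]⇒oddℤ-N (c + d i , refl) = c ℤ.- d ℤ.+ (c ℤ.* c ℤ.+ d ℤ.* d) , expand c d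
  where
  open import Data.Integer using (_+_; _*_; _-_)
  expand : ∀ c d → (1ℤ + (c * 1ℤ - d * 1ℤ)) * (1ℤ + (c * 1ℤ - d * 1ℤ))
                   + (0ℤ + (c * 1ℤ + d * 1ℤ)) * (0ℤ + (c * 1ℤ + d * 1ℤ))
                   ≡ 1ℤ + + 2 * (c - d + (c * c + d * d))
  expand = ℤ-Solver.solve-∀

Odd𝔾-∣ᵍ : ∀ {d x} → d ∣ᵍ x → Odd𝔾 x → Odd𝔾 d
Odd𝔾-∣ᵍ {d} {x} d∣x x-odd 1+i∣d = x-odd (∣ᵍ-trans {1+i} {d} {x} 1+i∣d d∣x)

-- Factorisations with exactly one odd exponent

EvenNat : ℕ → Set
EvenNat k = ∃ λ m → k ≡ 2 ℕ.* m

geomSum-parity : ∀ {p} → ≡1[mod1+i] p → ∀ k →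
  EvenNat k × ≡1[mod1+i] (geomSum p k) ⊎ OddNat k × 1+i ∣ᵍ geomSum p k
geomSum-parity p≡1 zero = inj₁ ((0 , refl) , (0ᵍ , refl))
geomSum-parity p≡1 (suc k) with geomSum-parity p≡1 k
... | inj₁ ((m , refl) , sum≡1) = inj₂ ((m , refl) , ≡1+≡1⇒1+i∣ sum≡1 (≡1[mod1+i]-^ᵍ p≡1 (suc k)))
... | inj₂ ((m , refl) , 1+i∣sum) =
  inj₁ ((suc m , cong suc (sym (ℕₚ.+-suc m (m ℕ.+ 0)))) , 1+i∣+≡1⇒≡1 1+i∣sum (≡1[mod1+i]-^ᵍ p≡1 (suc k)))

EvenExponents : List (𝔾 × ℕ) → Set
EvenExponents = All (EvenNat ∘ proj₂)

data OneOddExponent : List (𝔾 × ℕ) → Set where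
  here  : ∀ {p k fs} → OddNat k → EvenExponents fs → OneOddExponent ((p , k) ∷ fs)
  there : ∀ {p k fs} → EvenNat k → OneOddExponent fs → OneOddExponent ((p , k) ∷ fs)

sigmaFact-parity : ∀ fs → All (≡1[mod1+i] ∘ proj₁) fs →
    EvenExponents fs × ≡1[mod1+i] (sigmaFact fs)
  ⊎ OneOddExponent fs × 1+i ∣ᵍ sigmaFact fs
  ⊎ (1+i *ᵍ 1+i) ∣ᵍ sigmaFact fs
sigmaFact-parity [] [] = inj₁ ([] , 0ᵍ , refl)
sigmaFact-parity ((p , k) ∷ fs) (p≡1 ∷ ps) with geomSum-parity p≡1 k | sigmaFact-parity fs ps
... | inj₁ (k-even , sum≡1) | inj₁ (ks , σ≡1) = inj₁ (k-even ∷ ks , ≡1[mod1+i]-*ᵍ sum≡1 σ≡1)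
... | inj₁ (k-even , _) | inj₂ (inj₁ (one , 1+i∣σ)) =
  inj₂ (inj₁ (there k-even one , ∣ᵍ-*ˡ {1+i} {sigmaFact fs} (geomSum p k) 1+i∣σ))
... | inj₂ (k-odd , 1+i∣sum) | inj₁ (ks , _) =
  inj₂ (inj₁ (here k-odd ks , ∣ᵍ-*ʳ {1+i} {geomSum p k} (sigmaFact fs) 1+i∣sum))
... | inj₂ (_ , 1+i∣sum) | inj₂ (inj₁ (_ , 1+i∣σ)) =
  inj₂ (inj₂ (*ᵍ-mono-∣ᵍ {1+i} {1+i} {geomSum p k} {sigmaFact fs} 1+i∣sum 1+i∣σ))
... | _ | inj₂ (inj₂ [1+i]²∣σ) =
  inj₂ (inj₂ (∣ᵍ-*ˡ {1+i *ᵍ 1+i} {sigmaFact fs} (geomSum p k) [1+i]²∣σ))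

factors-≡1[mod1+i] : ∀ fs → All (λ pk → 1 ≤ proj₂ pk) fs → Odd𝔾 (evalFact fs) → All (≡1[mod1+i] ∘ proj₁) fs
factors-≡1[mod1+i] [] [] _ = []
factors-≡1[mod1+i] ((p , suc k) ∷ fs) (_ ∷ ks) odd =
  odd⇒≡1[mod1+i] p (Odd𝔾-∣ᵍ {p} {evalFact ((p , suc k) ∷ fs)} p∣ odd)
  ∷ factors-≡1[mod1+i] fs ks (Odd𝔾-∣ᵍ {evalFact fs} {evalFact ((p , suc k) ∷ fs)} (p ^ᵍ suc k , refl) odd)
  where
  rearrange : ∀ p q e → (p *ᵍ q) *ᵍ e ≡ (q *ᵍ e) *ᵍ p
  rearrange = solve-∀ 𝔾-ring
  p∣ : p ∣ᵍ evalFact ((p , suc k) ∷ fs)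
  p∣ = p ^ᵍ k *ᵍ evalFact fs , rearrange p (p ^ᵍ k) (evalFact fs)

sqrtFact : ∀ fs → EvenExponents fs → 𝔾
sqrtFact [] [] = 1ᵍ
sqrtFact ((p , _) ∷ fs) ((m , _) ∷ ks) = p ^ᵍ m *ᵍ sqrtFact fs ks

evalFact≡sqrtFact² : ∀ fs ks → evalFact fs ≡ sqrtFact fs ks *ᵍ sqrtFact fs ks
evalFact≡sqrtFact² [] [] = refl
evalFact≡sqrtFact² ((p , _) ∷ fs) ((m , refl) ∷ ks) =
  trans (cong₂ _*ᵍ_ (^ᵍ-double p m) (evalFact≡sqrtFact² fs ks)) (interchange (p ^ᵍ m) (sqrtFact fs ks))
  where
  interchange : ∀ a b → (a *ᵍ a) *ᵍ (b *ᵍ b) ≡ (a *ᵍ b) *ᵍ (a *ᵍ b)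
  interchange = solve-∀ 𝔾-ring

prime∤sqrtFact : ∀ {π} → GaussianPrime π → ∀ {fs} → All (GaussianPrime ∘ proj₁) fs →
                 All (λ qk → ¬ Associated (proj₁ qk) π) fs → (ks : EvenExponents fs) → ¬ π ∣ᵍ sqrtFact fs ks
prime∤sqrtFact π-prime [] [] [] = prime∤1 π-prime
prime∤sqrtFact π-prime {(q , _) ∷ fs} (q-prime ∷ qs) (q≁π ∷ q≁πs) ((m , _) ∷ ks) =
  prime∤*ᵍ (q ^ᵍ m) (sqrtFact fs ks) π-prime (prime∤^ᵍ π-prime q-prime q≁π m) (prime∤sqrtFact π-prime qs q≁πs ks)

record PrimePowerTimesSquare (fs : List (𝔾 × ℕ)) : Set where
  field
    π γ : 𝔾
    k : ℕ
    πk∈fs : (π , k) ∈ fs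
    k-odd : OddNat k
    π∤γ : ¬ π ∣ᵍ γ
    evalFact≡ : evalFact fs ≡ π ^ᵍ k *ᵍ (γ *ᵍ γ)

primePowerTimesSquare : ∀ {fs} → ValidFactorisation fs → OneOddExponent fs → PrimePowerTimesSquare fs
primePowerTimesSquare {(p , k) ∷ fs} ((p-prime , _) ∷ valid , p≁fs ∷ _) (here k-odd ks) = record
  { π = p ; γ = sqrtFact fs ks ; k = k ; πk∈fs = here refl ; k-odd = k-odd
  ; π∤γ = prime∤sqrtFact p-prime (All.map proj₁ valid) fs≁p ks
  ; evalFact≡ = cong (p ^ᵍ k *ᵍ_) (evalFact≡sqrtFact² fs ks) }
  where
  fs≁p : All (λ qk → ¬ Associated (proj₁ qk) p) fs
  fs≁p = All.map (λ {qk} p≁q → p≁q ∘ Associated-sym {proj₁ qk} {p}) p≁fs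
primePowerTimesSquare {(p , _) ∷ fs} ((p-prime , _) ∷ valid , p≁fs ∷ pairs) (there (m , refl) one) = record
  { π = π ; γ = p ^ᵍ m *ᵍ γ ; k = k ; πk∈fs = there πk∈fs ; k-odd = k-odd
  ; π∤γ = prime∤*ᵍ (p ^ᵍ m) γ π-prime (prime∤^ᵍ π-prime p-prime (All.lookup p≁fs πk∈fs) m) π∤γ
  ; evalFact≡ = trans (cong₂ _*ᵍ_ (^ᵍ-double p m) evalFact≡) (regroup (p ^ᵍ m) (π ^ᵍ k) γ) }
  where
  open PrimePowerTimesSquare (primePowerTimesSquare (valid , pairs) one)
  π-prime : GaussianPrime π
  π-prime = proj₁ (All.lookup valid πk∈fs)
  regroup : ∀ a b c → (a *ᵍ a) *ᵍ (b *ᵍ (c *ᵍ c)) ≡ b *ᵍ ((a *ᵍ c) *ᵍ (a *ᵍ c))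
  regroup = solve-∀ 𝔾-ring

absorb-unit-into-oddPower : ∀ {k} (k-odd : OddNat k) ε w x γ → ε ^ᵍ proj₁ k-odd *ᵍ w ≡ 1ᵍ →
                            ε *ᵍ (x ^ᵍ k *ᵍ (γ *ᵍ γ)) ≡ (ε *ᵍ x) ^ᵍ k *ᵍ (w *ᵍ γ) ^ᵍ 2
absorb-unit-into-oddPower (m , refl) ε w x γ εᵐw≡1 = begin
  ε *ᵍ (x *ᵍ x ^ᵍ (2 ℕ.* m) *ᵍ (γ *ᵍ γ))
    ≡⟨ cong (λ y → ε *ᵍ (x *ᵍ y *ᵍ (γ *ᵍ γ))) (^ᵍ-double x m) ⟩
  ε *ᵍ (x *ᵍ (xᵐ *ᵍ xᵐ) *ᵍ (γ *ᵍ γ))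
    ≡⟨ *ᵍ-identityˡ _ ⟨
  1ᵍ *ᵍ 1ᵍ *ᵍ (ε *ᵍ (x *ᵍ (xᵐ *ᵍ xᵐ) *ᵍ (γ *ᵍ γ)))
    ≡⟨ cong (λ e → e *ᵍ e *ᵍ (ε *ᵍ (x *ᵍ (xᵐ *ᵍ xᵐ) *ᵍ (γ *ᵍ γ)))) εᵐw≡1 ⟨
  εᵐ *ᵍ w *ᵍ (εᵐ *ᵍ w) *ᵍ (ε *ᵍ (x *ᵍ (xᵐ *ᵍ xᵐ) *ᵍ (γ *ᵍ γ)))
    ≡⟨ regroup ε x xᵐ εᵐ w γ ⟩
  ε *ᵍ x *ᵍ (εᵐ *ᵍ xᵐ *ᵍ (εᵐ *ᵍ xᵐ)) *ᵍ (w *ᵍ γ) ^ᵍ 2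
    ≡⟨ cong (λ y → ε *ᵍ x *ᵍ (y *ᵍ y) *ᵍ (w *ᵍ γ) ^ᵍ 2) (^ᵍ-distribʳ-*ᵍ ε x m) ⟨
  ε *ᵍ x *ᵍ ((ε *ᵍ x) ^ᵍ m *ᵍ (ε *ᵍ x) ^ᵍ m) *ᵍ (w *ᵍ γ) ^ᵍ 2
    ≡⟨ cong (λ y → ε *ᵍ x *ᵍ y *ᵍ (w *ᵍ γ) ^ᵍ 2) (^ᵍ-double (ε *ᵍ x) m) ⟨
  (ε *ᵍ x) ^ᵍ suc (2 ℕ.* m) *ᵍ (w *ᵍ γ) ^ᵍ 2
    ∎
  where
  open ≡-Reasoning
  εᵐ xᵐ : 𝔾
  εᵐ = ε ^ᵍ m
  xᵐ = x ^ᵍ m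
  regroup : ∀ ε x xᵐ εᵐ w γ → εᵐ *ᵍ w *ᵍ (εᵐ *ᵍ w) *ᵍ (ε *ᵍ (x *ᵍ (xᵐ *ᵍ xᵐ) *ᵍ (γ *ᵍ γ)))
                            ≡ ε *ᵍ x *ᵍ (εᵐ *ᵍ xᵐ *ᵍ (εᵐ *ᵍ xᵐ)) *ᵍ (w *ᵍ γ *ᵍ (w *ᵍ γ *ᵍ 1ᵍ))
  regroup = solve-∀ 𝔾-ring

oneOddExponent⇒primePower*square : ∀ {α ε fs} → IsUnit ε → ValidFactorisation fs → OneOddExponent fs →
  α ≡ ε *ᵍ evalFact fs →
  Σ 𝔾 λ π → Σ 𝔾 λ γ → Σ ℕ λ k → GaussianPrime π × CoprimeG π γ × OddNat k × α ≡ π ^ᵍ k *ᵍ γ ^ᵍ 2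
oneOddExponent⇒primePower*square {ε = ε} ε-unit valid one α≡ =
  ε *ᵍ π , w *ᵍ γ , k , GaussianPrime-*ᵍ-unit {ε} {π} ε-unit π-prime ,
  CoprimeG-*ᵍ-unit {ε} {w} {π} {γ} ε-unit w-unit (prime∤⇒coprime π-prime π∤γ) , k-odd ,
  trans α≡ (trans (cong (ε *ᵍ_) evalFact≡) (absorb-unit-into-oddPower k-odd ε w π γ εᵐw≡1))
  where
  open PrimePowerTimesSquare (primePowerTimesSquare valid one)
  π-prime : GaussianPrime π
  π-prime = proj₁ (All.lookup (proj₁ valid) πk∈fs)
  εᵐ w : 𝔾
  εᵐ = ε ^ᵍ proj₁ k-odd
  w = proj₁ (IsUnit-^ᵍ {ε} ε-unit (proj₁ k-odd))
  εᵐw≡1 : εᵐ *ᵍ w ≡ 1ᵍ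
  εᵐw≡1 = proj₂ (IsUnit-^ᵍ {ε} ε-unit (proj₁ k-odd))
  w-unit : IsUnit w
  w-unit = εᵐ , trans (*ᵍ-comm w εᵐ) εᵐw≡1

-- Norm-perfect odd numbers

double-norm⇒¬≡1[mod1+i] : ∀ {α σ} → N σ ≡ + 2 ℤ.* N α → ¬ ≡1[mod1+i] σ
double-norm⇒¬≡1[mod1+i] {α} Nσ≡ σ≡1 = evenℤ⇒¬oddℤ (N α , Nσ≡) (≡1[mod1+i]⇒oddℤ-N σ≡1)

odd-double-norm⇒¬[1+i]²∣ : ∀ {α σ} → Odd𝔾 α → N σ ≡ + 2 ℤ.* N α → ¬ (1+i *ᵍ 1+i) ∣ᵍ σ
odd-double-norm⇒¬[1+i]²∣ {α} α-odd Nσ≡ (t , refl) =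
  evenℤ⇒¬oddℤ (N t , Nα≡) (≡1[mod1+i]⇒oddℤ-N (odd⇒≡1[mod1+i] α α-odd))
  where
  Nα≡ : N α ≡ + 2 ℤ.* N t
  Nα≡ = ℤₚ.*-cancelˡ-≡ (+ 2) (N α) (+ 2 ℤ.* N t) (trans (sym Nσ≡) (trans (N-*ᵍ t (1+i *ᵍ 1+i)) (regroup (N t))))
    where
    regroup : ∀ n → n ℤ.* + 4 ≡ + 2 ℤ.* (+ 2 ℤ.* n)
    regroup = ℤ-Solver.solve-∀

mainTheorem2 : (α : 𝔾) → Odd𝔾 α → NormPerfect α →
    Σ 𝔾 λ π → Σ 𝔾 λ γ → Σ ℕ λ k →
      GaussianPrime π × CoprimeG π γ × OddNat k × α ≡ π ^ᵍ k *ᵍ γ ^ᵍ 2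
mainTheorem2 α α-odd (σ , (ε , fs , ε-unit , valid , α≡ , σ≡) , Nσ≡)
  with sigmaFact-parity fs (factors-≡1[mod1+i] fs (All.map (proj₂ ∘ proj₂) (proj₁ valid)) fs-odd)
  where
  fs-odd : Odd𝔾 (evalFact fs)
  fs-odd = Odd𝔾-∣ᵍ {evalFact fs} {α} (ε , α≡) α-odd
... | inj₁ (_ , σ≡1) = ⊥-elim (double-norm⇒¬≡1[mod1+i] {α} Nσ≡ (subst ≡1[mod1+i] (sym σ≡) σ≡1))
... | inj₂ (inj₂ [1+i]²∣σ) =
  ⊥-elim (odd-double-norm⇒¬[1+i]²∣ {α} {σ} α-odd Nσ≡ (subst ((1+i *ᵍ 1+i) ∣ᵍ_) (sym σ≡) [1+i]²∣σ))
... | inj₂ (inj₁ (one , _)) = oneOddExponent⇒primePower*square {α} {ε} ε-unit valid one α≡
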